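{- Let $k \ge 4$ and let $\Lambda_k$ be the poset consisting of a unique maximal element covering $k$ minimal elements (and no other elements). Then a permutation $w$ satisfies $\mathcal{P}(w) \cong \Lambda_k$ if and only if $w$ is a simple permutation in $\mathfrak{S}_k$. In particular, exactly $\mathrm{simp}(k)$ permutations have interval poset $\Lambda_k$, where $\mathrm{simp}(k)$ is the number of simple permutations in $\mathfrak{S}_k$.
   Context: For $w \in \mathfrak{S}_n$ in one-line notation $w(1)\cdots w(n)$, an interval of $w$ is a set of consecutive integers $[h,h+j]$ with $\{w(t) : t \in [i,i+j]\} = [h,h+j]$ for some $i$. The interval poset $\mathcal{P}(w)$ is the set of nonempty intervals of $w$ ordered by inclusion. An interval is proper if it has between $2$ and $n-1$ elements; $w$ is simple if it has no proper intervals. -}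

module Defs where

open import Data.Nat using (ℕ; zero; suc; _+_; _∸_; _≤_; _<_)
open import Data.Fin using (Fin; toℕ)
open import Data.Fin.Permutation using (Permutation′; _⟨$⟩ʳ_)
open import Data.Maybe using (Maybe; nothing; just)
open import Data.Product using (Σ; ∃; _×_; _,_; proj₁; proj₂)
open import Data.Sum using (_⊎_)
open import Relation.Binary.PropositionalEquality using (_≡_)
open import Relation.Nullary using (¬_)
open import Function.Bundles using (_⇔_)

-- Values/positions are 0-based: w(t) for t : Fin n, compared via toℕ.
-- The interval [h , h + j] (which has j+1 elements) is encoded by the pair (h , j).

IsInterval : {n : ℕ} → Permutation′ n → ℕ → ℕ → Set
IsInterval {n} w h j =
  h + j < n ×
  Σ ℕ λ i → i + j < n ×
    ((v : Fin n) →
      ((h ≤ toℕ v × toℕ v ≤ h + j) ⇔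
       (Σ (Fin n) λ t → (i ≤ toℕ t × toℕ t ≤ i + j) × w ⟨$⟩ʳ t ≡ v)))

_⊆I_ : ℕ × ℕ → ℕ × ℕ → Set
(h , j) ⊆I (h' , j') = h' ≤ h × h + j ≤ h' + j'

Proper : ℕ → ℕ → Set
Proper n j = 2 ≤ suc j × suc j ≤ n ∸ 1

Simple : {n : ℕ} → Permutation′ n → Set
Simple {n} w = (h j : ℕ) → IsInterval w h j → ¬ Proper n j

-- The poset Λ_k: carrier Maybe (Fin k); `nothing` is the unique maximal element,
-- `just a` (a : Fin k) are the k minimal elements; x ≤ y iff x = y or y is the top.
Λ : ℕ → Set
Λ k = Maybe (Fin k)

_≤Λ_ : {k : ℕ} → Λ k → Λ k → Set
x ≤Λ y = x ≡ y ⊎ y ≡ nothing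

record IntervalPosetIso {n : ℕ} (w : Permutation′ n) (k : ℕ) : Set where
  field
    to       : ℕ × ℕ → Λ k
    back     : Λ k → ℕ × ℕ
    back-int : (x : Λ k) → IsInterval w (proj₁ (back x)) (proj₂ (back x))
    to-back  : (x : Λ k) → to (back x) ≡ x
    back-to  : (h j : ℕ) → IsInterval w h j → back (to (h , j)) ≡ (h , j)
    order    : (h j h' j' : ℕ) → IsInterval w h j → IsInterval w h' j' →
               (((h , j) ⊆I (h' , j')) ⇔ (to (h , j) ≤Λ to (h' , j')))

_≅Λ_ : {n : ℕ} → Permutation′ n → ℕ → Set
w ≅Λ k = IntervalPosetIso w k

-- Both sides of the equivalence say that the only intervals of w are the n singletons
-- and the whole of [0, n-1].  For a simple w this is the definition, and matching
-- singletons with minimal elements gives 𝒫(w) ≅ Λₙ.  Conversely, under an isomorphism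
-- with Λ_k the whole interval lies above everything, so it is the top; a singleton
-- lies below nothing but the whole, so it is minimal; and an interval with two or more
-- elements lies strictly above a singleton, so it is the top, hence the whole.  The
-- singletons are then in bijection with the k minimal elements, so n = k.
module Submission where

open import Defs
open import Data.Nat using (ℕ; zero; suc; _+_; _≤_; _<_; z≤n; s≤s; _<?_)
open import Data.Nat.Properties
  using (+-identityʳ; ≤-refl; ≤-trans; ≤-antisym; ≤-pred; m≤m+n; +-monoʳ-≤; m+n≤o⇒n≤o; +-cancelʳ-≤;
         n≤0⇒n≡0; ≮⇒≥; <-irrefl; n≮0; 0≢1+n)
open import Data.Fin using (Fin; toℕ; fromℕ<) renaming (zero to fzero)
open import Data.Fin.Properties
  using (toℕ-injective; toℕ<n; toℕ≤pred[n]; toℕ-fromℕ<; fromℕ<-toℕ; fromℕ<-cong;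
         fromℕ<-injective; injective⇒≤)
open import Data.Fin.Permutation using (Permutation′; _⟨$⟩ʳ_; _⟨$⟩ˡ_; inverseʳ)
open import Data.Maybe using (Maybe; just; nothing)
open import Data.Maybe.Properties using (just-injective)
open import Data.Product using (Σ; _×_; _,_; proj₁; proj₂)
open import Data.Sum using (inj₁; inj₂)
open import Data.Empty using (⊥-elim)
open import Function using (_∘_)
open import Function.Bundles using (_⇔_; mk⇔; Equivalence)
import Function.Properties.Equivalence as ⇔
open import Function.Definitions using (Injective)
open import Relation.Nullary using (¬_; yes; no)
open import Relation.Binary.PropositionalEquality
  using (_≡_; _≢_; refl; sym; trans; cong; cong₂; subst)

just≢nothing : {A : Set} {a : A} → just a ≢ nothing
just≢nothing ()

just-of-≢nothing : {A : Set} (x : Maybe A) → x ≢ nothing → Σ A λ a → x ≡ just a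
just-of-≢nothing (just a) _        = a , refl
just-of-≢nothing nothing  x≢nothing = ⊥-elim (x≢nothing refl)

≤Λ-≢⇒top : {k : ℕ} {x y : Λ k} → x ≤Λ y → x ≢ y → y ≡ nothing
≤Λ-≢⇒top (inj₁ x≡y) x≢y = ⊥-elim (x≢y x≡y)
≤Λ-≢⇒top (inj₂ top)  _   = top

just-≤Λ-just : {k : ℕ} {a b : Fin k} → (just a ≤Λ just b) ⇔ (a ≡ b)
just-≤Λ-just = mk⇔ (λ { (inj₁ e) → just-injective e ; (inj₂ ()) }) (inj₁ ∘ cong just)

⊆I-singleton-start : {h j : ℕ} → (h , 0) ⊆I (h , j)
⊆I-singleton-start {h} = ≤-refl , +-monoʳ-≤ h z≤n

singleton-⊆I-singleton : {h h' : ℕ} → ((h , 0) ⊆I (h' , 0)) ⇔ (h ≡ h')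
singleton-⊆I-singleton {h} {h'} = mk⇔
  (λ (h'≤h , h+0≤h'+0) → ≤-antisym (+-cancelʳ-≤ 0 h h' h+0≤h'+0) h'≤h)
  (λ { refl → ≤-refl , ≤-refl })

⊆I-whole : {h j m : ℕ} → h + j < suc m → (h , j) ⊆I (0 , m)
⊆I-whole h+j<1+m = z≤n , ≤-pred h+j<1+m

whole-⊈I-singleton : {h m : ℕ} → ¬ ((0 , suc m) ⊆I (h , 0))
whole-⊈I-singleton (z≤n , ())

module _ {n : ℕ} (w : Permutation′ n) where

  interval-start< : {h j : ℕ} → IsInterval w h j → h < n
  interval-start< {h} {j} (h+j<n , _) = ≤-trans (s≤s (m≤m+n h j)) h+j<n

  singleton-isInterval : {h : ℕ} → h < n → IsInterval w h 0
  singleton-isInterval {h} h<n =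
    subst (_< n) (sym (+-identityʳ h)) h<n , toℕ t₀ ,
    subst (_< n) (sym (+-identityʳ (toℕ t₀))) (toℕ<n t₀) ,
    λ v → mk⇔ (hit v) (preimage v)
    where
    pinched : {a b : ℕ} → a ≤ b → b ≤ a + 0 → b ≡ a
    pinched {a} a≤b b≤a+0 = ≤-antisym (subst (_ ≤_) (+-identityʳ a) b≤a+0) a≤b
    t₀ : Fin n
    t₀ = w ⟨$⟩ˡ fromℕ< h<n
    hit : (v : Fin n) → h ≤ toℕ v × toℕ v ≤ h + 0 →
          Σ (Fin n) λ t → (toℕ t₀ ≤ toℕ t × toℕ t ≤ toℕ t₀ + 0) × w ⟨$⟩ʳ t ≡ v
    hit v (h≤v , v≤h) = t₀ , (≤-refl , m≤m+n _ 0) ,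
      trans (inverseʳ w) (toℕ-injective (trans (toℕ-fromℕ< h<n) (sym (pinched h≤v v≤h))))
    preimage : (v : Fin n) →
               (Σ (Fin n) λ t → (toℕ t₀ ≤ toℕ t × toℕ t ≤ toℕ t₀ + 0) × w ⟨$⟩ʳ t ≡ v) →
               h ≤ toℕ v × toℕ v ≤ h + 0
    preimage v (t , (t₀≤t , t≤t₀) , wt≡v) rewrite toℕ-injective (pinched t₀≤t t≤t₀)
                                             | sym wt≡v | inverseʳ w {fromℕ< h<n}
                                             | toℕ-fromℕ< h<n = ≤-refl , m≤m+n h 0

whole-isInterval : {m : ℕ} (w : Permutation′ (suc m)) → IsInterval w 0 m
whole-isInterval {m} w = ≤-refl , 0 , ≤-refl , λ v → mk⇔
  (λ _ → w ⟨$⟩ˡ v , (z≤n , toℕ≤pred[n] (w ⟨$⟩ˡ v)) , inverseʳ w)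
  (λ _ → z≤n , toℕ≤pred[n] v)

interval-of-length-one : {h j : ℕ} (w : Permutation′ 1) → IsInterval w h j → (h , j) ≡ (0 , 0)
interval-of-length-one {zero}  {zero}  _ _            = refl
interval-of-length-one {zero}  {suc _} _ (s≤s () , _)
interval-of-length-one {suc _}         _ (s≤s () , _)

HasOnlyTrivialIntervals : {m : ℕ} → Permutation′ (suc (suc m)) → Set
HasOnlyTrivialIntervals {m} w =
  ∀ {h j} → IsInterval w h (suc j) → (h , suc j) ≡ (0 , suc m)

module _ {m : ℕ} (w : Permutation′ (suc (suc m))) where

  simple⇒hasOnlyTrivialIntervals : Simple w → HasOnlyTrivialIntervals w
  simple⇒hasOnlyTrivialIntervals simple {h} {j} I = cong₂ _,_ start≡0 length≡
    where
    fits : h + suc j ≤ suc m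
    fits = ≤-pred (proj₁ I)
    length≡ : suc j ≡ suc m
    length≡ = ≤-antisym (m+n≤o⇒n≤o h fits)
                        (≮⇒≥ λ shorter → simple h (suc j) I (s≤s (s≤s z≤n) , shorter))
    start≡0 : h ≡ 0
    start≡0 = n≤0⇒n≡0 (+-cancelʳ-≤ (suc j) h 0 (subst (h + suc j ≤_) (sym length≡) fits))

  hasOnlyTrivialIntervals⇒simple : HasOnlyTrivialIntervals w → Simple w
  hasOnlyTrivialIntervals⇒simple _       h zero    _ (s≤s () , _)
  hasOnlyTrivialIntervals⇒simple trivial h (suc j) I (_ , shorter) =
    <-irrefl (cong proj₂ (trivial I)) shorter

module _ {n k : ℕ} {w : Permutation′ n} (iso : w ≅Λ k) where
  open IntervalPosetIso iso

  back-injective : {x y : Λ k} → back x ≡ back y → x ≡ y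
  back-injective {x} {y} e = trans (sym (to-back x)) (trans (cong to e) (to-back y))

  to-injective : {h j h' j' : ℕ} → IsInterval w h j → IsInterval w h' j' →
                 to (h , j) ≡ to (h' , j') → (h , j) ≡ (h' , j')
  to-injective I I' e = trans (sym (back-to _ _ I)) (trans (cong back e) (back-to _ _ I'))

module FromΛ {m k : ℕ} {w : Permutation′ (suc (suc m))} (iso : w ≅Λ k) where
  open IntervalPosetIso iso

  whole : IsInterval w 0 (suc m)
  whole = whole-isInterval w

  singleton : (t : Fin (suc (suc m))) → IsInterval w (toℕ t) 0
  singleton t = singleton-isInterval w (toℕ<n t)

  singleton-not-top : {h : ℕ} → IsInterval w h 0 → to (h , 0) ≢ nothing
  singleton-not-top I top =
    whole-⊈I-singleton (Equivalence.from (order _ _ _ _ whole I) (inj₂ top))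

  nonsingleton-top : {h j : ℕ} → IsInterval w h (suc j) → to (h , suc j) ≡ nothing
  nonsingleton-top I = ≤Λ-≢⇒top (Equivalence.to (order _ _ _ _ S I) ⊆I-singleton-start)
                                (0≢1+n ∘ cong proj₂ ∘ to-injective iso S I)
    where S = singleton-isInterval w (interval-start< w I)

  hasOnlyTrivialIntervals : HasOnlyTrivialIntervals w
  hasOnlyTrivialIntervals I =
    to-injective iso I whole (trans (nonsingleton-top I) (sym (nonsingleton-top whole)))

  minimal-is-singleton : (a : Fin k) → proj₂ (back (just a)) ≡ 0
  minimal-is-singleton a with back (just a) | back-int (just a) | to-back (just a)
  ... | _ , zero  | _ | _         = refl
  ... | _ , suc _ | I | to-back-a = ⊥-elim (just≢nothing (trans (sym to-back-a) (nonsingleton-top I)))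

  label : Fin (suc (suc m)) → Fin k
  label t = proj₁ (just-of-≢nothing _ (singleton-not-top (singleton t)))

  label-injective : Injective _≡_ _≡_ label
  label-injective {t} {t'} e = toℕ-injective (cong proj₁
    (to-injective iso (singleton t) (singleton t')
      (trans (labelled t) (trans (cong just e) (sym (labelled t'))))))
    where
    labelled : (t : Fin (suc (suc m))) → to (toℕ t , 0) ≡ just (label t)
    labelled t = proj₂ (just-of-≢nothing _ (singleton-not-top (singleton t)))

  position : Fin k → Fin (suc (suc m))
  position a = fromℕ< (interval-start< w (back-int (just a)))

  position-injective : Injective _≡_ _≡_ position
  position-injective {a} {b} e = just-injective (back-injective iso (cong₂ _,_
    (trans (sym (toℕ-fromℕ< (interval-start< w (back-int (just a)))))
      (trans (cong toℕ e) (toℕ-fromℕ< (interval-start< w (back-int (just b))))))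
    (trans (minimal-is-singleton a) (sym (minimal-is-singleton b)))))

  length≡ : suc (suc m) ≡ k
  length≡ = ≤-antisym (injective⇒≤ label-injective) (injective⇒≤ position-injective)

≅Λ⇒simple : {n k : ℕ} (w : Permutation′ n) → w ≅Λ suc k → n ≡ suc k × Simple w
≅Λ⇒simple {zero} w iso =
  ⊥-elim (n≮0 (interval-start< w (IntervalPosetIso.back-int iso nothing)))
≅Λ⇒simple {suc zero} w iso = ⊥-elim (just≢nothing (back-injective iso
  (trans (interval-of-length-one w (back-int (just fzero)))
         (sym (interval-of-length-one w (back-int nothing))))))
  where open IntervalPosetIso iso
≅Λ⇒simple {suc (suc m)} w iso =
  FromΛ.length≡ iso , hasOnlyTrivialIntervals⇒simple w (FromΛ.hasOnlyTrivialIntervals iso)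

module ToΛ {m : ℕ} (w : Permutation′ (suc (suc m))) (trivial : HasOnlyTrivialIntervals w) where
  n : ℕ
  n = suc (suc m)

  point : ℕ → Λ n
  point h with h <? n
  ... | yes h<n = just (fromℕ< h<n)
  ... | no  _   = nothing

  point-fromℕ< : {h : ℕ} (h<n : h < n) → point h ≡ just (fromℕ< h<n)
  point-fromℕ< {h} h<n with h <? n
  ... | yes _   = refl
  ... | no  h≮n = ⊥-elim (h≮n h<n)

  to : ℕ × ℕ → Λ n
  to (h , zero)  = point h
  to (_ , suc _) = nothing

  back : Λ n → ℕ × ℕ
  back (just a) = toℕ a , 0
  back nothing  = 0 , suc m

  back-int : (x : Λ n) → IsInterval w (proj₁ (back x)) (proj₂ (back x))
  back-int (just a) = singleton-isInterval w (toℕ<n a)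
  back-int nothing  = whole-isInterval w

  to-back : (x : Λ n) → to (back x) ≡ x
  to-back (just a) = trans (point-fromℕ< (toℕ<n a)) (cong just (fromℕ<-toℕ a (toℕ<n a)))
  to-back nothing  = refl

  back-to : (h j : ℕ) → IsInterval w h j → back (to (h , j)) ≡ (h , j)
  back-to h zero I rewrite point-fromℕ< (interval-start< w I) =
    cong (_, 0) (toℕ-fromℕ< (interval-start< w I))
  back-to h (suc j) I = sym (trivial I)

  order : (h j h' j' : ℕ) → IsInterval w h j → IsInterval w h' j' →
          ((h , j) ⊆I (h' , j')) ⇔ (to (h , j) ≤Λ to (h' , j'))
  order h zero h' zero I I'
    rewrite point-fromℕ< (interval-start< w I) | point-fromℕ< (interval-start< w I') =
    ⇔.trans singleton-⊆I-singleton
      (⇔.trans (mk⇔ (λ e → fromℕ<-cong h h' e _ _) (fromℕ<-injective h h' _ _))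
               (⇔.sym just-≤Λ-just))
  order h zero h' (suc j') I I' with trivial I'
  ... | refl = mk⇔ (λ _ → inj₂ refl) (λ _ → ⊆I-whole (proj₁ I))
  order h (suc j) h' zero I I' with trivial I
  ... | refl rewrite point-fromℕ< (interval-start< w I') =
    mk⇔ (⊥-elim ∘ whole-⊈I-singleton) λ { (inj₁ ()) ; (inj₂ ()) }
  order h (suc j) h' (suc j') I I' with trivial I | trivial I'
  ... | refl | refl = mk⇔ (λ _ → inj₁ refl) (λ _ → ≤-refl , ≤-refl)

  iso : w ≅Λ n
  iso = record { to = to ; back = back ; back-int = back-int ; to-back = to-back
               ; back-to = back-to ; order = order }

simple⇒≅Λ : {m : ℕ} (w : Permutation′ (suc (suc m))) → Simple w → w ≅Λ suc (suc m)
simple⇒≅Λ w simple = ToΛ.iso w (simple⇒hasOnlyTrivialIntervals w simple)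

proposition4p3 : (k : ℕ) → 4 ≤ k → (n : ℕ) → (w : Permutation′ n) →
    ((w ≅Λ k) ⇔ (Σ (n ≡ k) λ _ → Simple w))
proposition4p3 (suc (suc k)) (s≤s (s≤s _)) n w =
  mk⇔ (≅Λ⇒simple {k = suc k} w) λ { (refl , simple) → simple⇒≅Λ w simple }
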